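{- Let $H$ be a hypergraph and let $v$ be a vertex of $H$ that is not isolated and not contained in any induced Berge cycle of length $3$. Let $e_1, \ldots, e_k$ be the edges of $H$ containing $v$ and $\tilde{e}_i = e_i \setminus \{v\}$. For $i \in \{1,\ldots,k\}$ define the hypergraph $H_i$ on $V(H) \setminus \{v\}$ by \[ H_i = \{ e \setminus e_i : e \in H \setminus \{e_1, \ldots, e_k\} \} \cup \{\tilde{e}_1, \ldots, \tilde{e}_k\} \] (edges of $H_i$ need not be inclusion-minimal). Then $I(H_i) = \mathrm{st}(v) \cap \mathrm{st}(\tilde{e}_i)$, where the stars are taken in $I(H)$.
   Context: A hypergraph $H$ on a finite set $V=V(H)$ is a collection of nonempty subsets of $V$, called edges. Standing convention for $H$: every edge is inclusion-minimal (no edge properly contains another edge) and has size at least $2$. The independence complex $I(F)$ of a hypergraph $F$ on a vertex set $W$ is the simplicial complex of all subsets of $W$ containing no edge of $F$. A vertex is isolated if it lies in no edge. A Berge cycle of length $k$ in $H$ is an alternating sequence $v_1 e_1 \cdots v_k e_k$ of $k$ distinct vertices and $k$ distinct edges with $v_i, v_{i+1} \in e_i$ (indices mod $k$); it is induced if $e_i \cap \{v_1,\ldots,v_k\} = \{v_i,v_{i+1}\}$ for all $i$ and no edge contains two non-consecutive vertices of the cycle. For a simplicial complex $X$ on $V$ and $\sigma \in X$, $\mathrm{st}_X(\sigma) = \{\tau \subseteq V : \tau \cup \sigma \in X\}$. -}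

module Defs where

open import Data.Nat using (ℕ; _≥_)
open import Data.Fin using (Fin)
open import Data.Fin.Subset using (Subset; _∈_; _∉_; _⊆_; _∪_; _─_; _-_; ∣_∣)
open import Data.List using (List)
import Data.List.Membership.Propositional as LM
open import Data.Product using (Σ; _×_; ∃)
open import Data.Sum using (_⊎_)
open import Relation.Binary.PropositionalEquality using (_≡_; _≢_)
open import Relation.Nullary using (¬_)

-- A hypergraph on the vertex set Fin n, given by its (finite) list of edges.
-- The collection of edges is the set of members of the list.
Hypergraph : ℕ → Set
Hypergraph n = List (Subset n)

_∈E_ : ∀ {n} → Subset n → Hypergraph n → Set
e ∈E H = e LM.∈ H

StandingConvention : ∀ {n} → Hypergraph n → Set
StandingConvention H =
  (∀ e → e ∈E H → ∣ e ∣ ≥ 2) ×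
  (∀ e f → e ∈E H → f ∈E H → e ⊆ f → e ≡ f)

Isolated : ∀ {n} → Hypergraph n → Fin n → Set
Isolated H v = ∀ e → e ∈E H → v ∉ e

IndepP : ∀ {n} → (Subset n → Set) → Subset n → Set
IndepP F τ = ∀ e → F e → ¬ (e ⊆ τ)

Indep : ∀ {n} → Hypergraph n → Subset n → Set
Indep H = IndepP (λ e → e ∈E H)

Star : ∀ {n} → (Subset n → Set) → Subset n → Subset n → Set
Star X σ τ = X (τ ∪ σ)

-- Induced Berge cycle v₁ e₁ v₂ e₂ v₃ e₃ of length 3: distinct vertices a b c,
-- distinct edges f₁ f₂ f₃ of H with f₁ ∩ {a,b,c} = {a,b}, f₂ ∩ {a,b,c} = {b,c},
-- f₃ ∩ {a,b,c} = {c,a}.  (For length 3 every pair of cycle vertices is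
-- consecutive, so the "non-consecutive" condition is vacuous.)
record InducedBerge3 {n} (H : Hypergraph n) : Set where
  field
    a b c : Fin n
    f₁ f₂ f₃ : Subset n
    a≢b : a ≢ b
    b≢c : b ≢ c
    c≢a : c ≢ a
    f₁∈H : f₁ ∈E H
    f₂∈H : f₂ ∈E H
    f₃∈H : f₃ ∈E H
    f₁≢f₂ : f₁ ≢ f₂
    f₂≢f₃ : f₂ ≢ f₃
    f₃≢f₁ : f₃ ≢ f₁
    a∈f₁ : a ∈ f₁
    b∈f₁ : b ∈ f₁
    c∉f₁ : c ∉ f₁
    b∈f₂ : b ∈ f₂
    c∈f₂ : c ∈ f₂
    a∉f₂ : a ∉ f₂
    c∈f₃ : c ∈ f₃
    a∈f₃ : a ∈ f₃
    b∉f₃ : b ∉ f₃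

OnCycle : ∀ {n} {H : Hypergraph n} → Fin n → InducedBerge3 H → Set
OnCycle v C = (v ≡ a) ⊎ (v ≡ b) ⊎ (v ≡ c)
  where open InducedBerge3 C

-- Edges of H_i, where eᵢ is an edge of H containing v:
--   { f ∖ eᵢ : f ∈ H, v ∉ f }  ∪  { f ∖ {v} : f ∈ H, v ∈ f }.
-- (The edges of H not containing v are exactly H ∖ {e₁,…,e_k}.)
EdgeHi : ∀ {n} → Hypergraph n → Fin n → Subset n → Subset n → Set
EdgeHi H v eᵢ g =
  (Σ (Subset _) λ f → f ∈E H × v ∉ f × g ≡ f ─ eᵢ) ⊎
  (Σ (Subset _) λ f → f ∈E H × v ∈ f × g ≡ f - v)

{-# OPTIONS --safe #-}
module Submission where

-- The identity is pure set algebra and needs none of the hypotheses on H and v.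
-- Everything reduces to f ∖ q ⊆ τ ⇔ f ⊆ τ ∪ q: an edge f ∋ v of H is blocked
-- in H_i (f - v ⊄ τ) exactly when it is blocked in st(v), and an edge f ∌ v is
-- blocked in H_i (f ∖ eᵢ ⊄ τ) exactly when it is blocked in st(ẽᵢ).  Edges
-- through v are automatically blocked in st(ẽᵢ) because v ∉ τ ∪ ẽᵢ, and edges
-- avoiding v are blocked in st(v) because τ ∪ {v} ⊆ τ ∪ eᵢ.

open import Defs
open import Data.Nat using (ℕ)
open import Data.Fin using (Fin)
open import Data.Empty using (⊥-elim)
open import Data.Fin.Subset using (Subset; _∈_; _∉_; _⊆_; ⁅_⁆; _-_; _─_; _∪_; inside; outside)
open import Data.Fin.Subset.Properties
  using (_∈?_; ⊆-trans; x∈p∪q⁻; x∈p∪q⁺; x∈⁅y⁆⇒x≡y; x∈⁅x⁆; p─q⊆p; x∈p∧x∉q⇒x∈p─q; x∈p∧x≢y⇒x∈p-y)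
open import Data.Product using (_×_; _,_)
open import Data.Sum using (inj₁; inj₂; [_,_]′)
open import Data.Vec using (_∷_; here; there)
open import Function using (_∘_)
open import Function.Bundles using (_⇔_; mk⇔)
open import Relation.Nullary using (¬_; yes; no)
open import Relation.Binary.PropositionalEquality using (refl; sym; subst)

private
  variable
    n : ℕ
    x : Fin n

x∈p─q⇒x∉q : ∀ (p q : Subset n) → x ∈ p ─ q → x ∉ q
x∈p─q⇒x∉q (inside ∷ p) (outside ∷ q) here        ()
x∈p─q⇒x∉q (_      ∷ p) (_       ∷ q) (there x∈p─q) (there x∈q) = x∈p─q⇒x∉q p q x∈p─q x∈q

p─q⊆r⇒p⊆r∪q : ∀ (p q r : Subset n) → p ─ q ⊆ r → p ⊆ r ∪ q
p─q⊆r⇒p⊆r∪q p q r p─q⊆r {x} x∈p with x ∈? q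
... | yes x∈q = x∈p∪q⁺ (inj₂ x∈q)
... | no  x∉q = x∈p∪q⁺ (inj₁ (p─q⊆r (x∈p∧x∉q⇒x∈p─q x∈p x∉q)))

p⊆r∪q⇒p─q⊆r : ∀ (p q r : Subset n) → p ⊆ r ∪ q → p ─ q ⊆ r
p⊆r∪q⇒p─q⊆r p q r p⊆r∪q x∈p─q =
  [ (λ x∈r → x∈r) , (λ x∈q → ⊥-elim (x∈p─q⇒x∉q p q x∈p─q x∈q)) ]′
    (x∈p∪q⁻ r q (p⊆r∪q (p─q⊆p p q x∈p─q)))

∪-monoʳ-⊆ : ∀ (r : Subset n) {p q : Subset n} → p ⊆ q → r ∪ p ⊆ r ∪ q
∪-monoʳ-⊆ r p⊆q x∈r∪p = [ x∈p∪q⁺ ∘ inj₁ , x∈p∪q⁺ ∘ inj₂ ∘ p⊆q ]′ (x∈p∪q⁻ r _ x∈r∪p)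

x∈q⇒⁅x⁆⊆q : ∀ {q : Subset n} → x ∈ q → ⁅ x ⁆ ⊆ q
x∈q⇒⁅x⁆⊆q {q = q} x∈q y∈⁅x⁆ = subst (_∈ q) (sym (x∈⁅y⁆⇒x≡y _ y∈⁅x⁆)) x∈q

x∉p∧p⊆r∪q⇒p⊆r∪q-x : ∀ {p q r : Subset n} → x ∉ p → p ⊆ r ∪ q → p ⊆ r ∪ (q - x)
x∉p∧p⊆r∪q⇒p⊆r∪q-x {r = r} x∉p p⊆r∪q {y} y∈p =
  [ x∈p∪q⁺ ∘ inj₁ , (λ y∈q → x∈p∪q⁺ (inj₂ (x∈p∧x≢y⇒x∈p-y y∈q (λ { refl → x∉p y∈p })))) ]′
    (x∈p∪q⁻ r _ (p⊆r∪q y∈p))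

x∉r⇒x∉r∪q-x : ∀ {q r : Subset n} → x ∉ r → x ∉ r ∪ (q - x)
x∉r⇒x∉r∪q-x {x = x} {q} {r} x∉r x∈r∪q-x =
  [ x∉r , (λ x∈q-x → x∈p─q⇒x∉q q ⁅ x ⁆ x∈q-x (x∈⁅x⁆ x)) ]′ (x∈p∪q⁻ r _ x∈r∪q-x)

module _ (H : Hypergraph n) (v : Fin n) (eᵢ τ : Subset n) where

  IndepHᵢ⇒Star-v : v ∈ eᵢ → IndepP (EdgeHi H v eᵢ) τ → Star (Indep H) ⁅ v ⁆ τ
  IndepHᵢ⇒Star-v v∈eᵢ indep f f∈H f⊆τ∪v with v ∈? f
  ... | yes v∈f = indep (f - v) (inj₂ (f , f∈H , v∈f , refl)) (p⊆r∪q⇒p─q⊆r f ⁅ v ⁆ τ f⊆τ∪v)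
  ... | no  v∉f = indep (f ─ eᵢ) (inj₁ (f , f∈H , v∉f , refl))
    (p⊆r∪q⇒p─q⊆r f eᵢ τ (⊆-trans f⊆τ∪v (∪-monoʳ-⊆ τ (x∈q⇒⁅x⁆⊆q v∈eᵢ))))

  IndepHᵢ⇒Star-ẽᵢ : v ∉ τ → IndepP (EdgeHi H v eᵢ) τ → Star (Indep H) (eᵢ - v) τ
  IndepHᵢ⇒Star-ẽᵢ v∉τ indep f f∈H f⊆τ∪ẽᵢ with v ∈? f
  ... | yes v∈f = x∉r⇒x∉r∪q-x v∉τ (f⊆τ∪ẽᵢ v∈f)
  ... | no  v∉f = indep (f ─ eᵢ) (inj₁ (f , f∈H , v∉f , refl))
    (p⊆r∪q⇒p─q⊆r f eᵢ τ (⊆-trans f⊆τ∪ẽᵢ (∪-monoʳ-⊆ τ (p─q⊆p eᵢ ⁅ v ⁆))))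

  Star-v×Star-ẽᵢ⇒IndepHᵢ : Star (Indep H) ⁅ v ⁆ τ × Star (Indep H) (eᵢ - v) τ →
                           IndepP (EdgeHi H v eᵢ) τ
  Star-v×Star-ẽᵢ⇒IndepHᵢ (_ , star-ẽᵢ) _ (inj₁ (f , f∈H , v∉f , refl)) f─eᵢ⊆τ =
    star-ẽᵢ f f∈H (x∉p∧p⊆r∪q⇒p⊆r∪q-x v∉f (p─q⊆r⇒p⊆r∪q f eᵢ τ f─eᵢ⊆τ))
  Star-v×Star-ẽᵢ⇒IndepHᵢ (star-v , _) _ (inj₂ (f , f∈H , v∈f , refl)) f-v⊆τ =
    star-v f f∈H (p─q⊆r⇒p⊆r∪q f ⁅ v ⁆ τ f-v⊆τ)

lemma4p4 : ∀ {n} (H : Hypergraph n) → StandingConvention H →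
    (v : Fin n) → ¬ Isolated H v →
    ((C : InducedBerge3 H) → ¬ OnCycle v C) →
    (eᵢ : Subset n) → eᵢ ∈E H → v ∈ eᵢ →
    (τ : Subset n) → v ∉ τ →
    IndepP (EdgeHi H v eᵢ) τ ⇔
      (Star (Indep H) ⁅ v ⁆ τ × Star (Indep H) (eᵢ - v) τ)
lemma4p4 H _ v _ _ eᵢ _ v∈eᵢ τ v∉τ = mk⇔
  (λ indep → IndepHᵢ⇒Star-v H v eᵢ τ v∈eᵢ indep , IndepHᵢ⇒Star-ẽᵢ H v eᵢ τ v∉τ indep)
  (Star-v×Star-ẽᵢ⇒IndepHᵢ H v eᵢ τ)
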